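{- Let $h\geq r\geq s\geq 2$ be integers and let $H$ be an $r$-graph with $|V(H)|=h$ and $s(H)=s$. Then for all nonnegative integers $k_2\leq k_1$ with $k_1\geq 1$, $$\mathrm{wsat}(k_1+k_2,H)\leq \mathrm{wsat}(k_1,H)+r h^r k_1^{s-2}k_2.$$
   Context: An $r$-graph is a pair $(V,E)$ with $E\subseteq\binom{V}{r}$ (the $r$-element subsets of $V$). $G=(V,E)$ is weakly $H$-saturated if the elements of $\binom{V}{r}\setminus E$ admit an ordering $e_1,\dots,e_k$ such that for each $i$ the $r$-graph $G\cup\{e_1,\dots,e_i\}$ contains a copy of $H$ containing $e_i$. $\mathrm{wsat}(n,H)$ is the smallest number of edges of a weakly $H$-saturated $r$-graph on $n$ vertices. The sparseness $s(H)$ is the smallest size of a vertex set $W\subseteq V(H)$ contained in precisely one edge of $H$. -}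

module Defs where

open import Data.Nat using (ℕ; zero; suc; _≤_)
open import Data.Fin using (Fin)
import Data.Fin as Fin
open import Data.Fin.Subset using (Subset; ∣_∣; _⊆_; _∪_; ⁅_⁆; ⊥)
open import Data.Vec using (_∷_; [])
open import Data.List using (List; length; _∷_; [])
open import Data.List.Membership.Propositional using (_∈_; _∉_)
open import Data.List.Relation.Unary.All using (All)
open import Data.List.Relation.Unary.Unique.Propositional using (Unique)
open import Data.Product using (Σ; ∃; _×_; _,_)
open import Data.Unit using (⊤)
open import Data.Bool using (if_then_else_)
open import Function.Definitions using (Injective)
open import Relation.Binary.PropositionalEquality using (_≡_)

record RGraph (r n : ℕ) : Set where
  field
    edges   : List (Subset n)
    unique  : Unique edges
    uniform : All (λ e → ∣ e ∣ ≡ r) edges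
open RGraph public

∥_∥ : ∀ {r n} → RGraph r n → ℕ
∥ G ∥ = length (edges G)

image : ∀ {h n} → (Fin h → Fin n) → Subset h → Subset n
image φ []      = ⊥
image φ (b ∷ W) = (if b then ⁅ φ Fin.zero ⁆ else ⊥) ∪ image (λ i → φ (Fin.suc i)) W

CopyContaining : ∀ {r h n} → RGraph r h → List (Subset n) → Subset n → Set
CopyContaining {h = h} {n = n} H E e =
  Σ (Fin h → Fin n) λ φ →
    Injective _≡_ _≡_ φ
    × All (λ f → image φ f ∈ E) (edges H)
    × ∃ λ f → f ∈ edges H × image φ f ≡ e

Completes : ∀ {r h n} → RGraph r h → List (Subset n) → List (Subset n) → Set
Completes H E []       = ⊤
Completes H E (e ∷ L) = CopyContaining H (e ∷ E) e × Completes H (e ∷ E) L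

IsNonEdgeOrdering : ∀ {r n} → RGraph r n → List (Subset n) → Set
IsNonEdgeOrdering {r} {n} G L =
  Unique L
  × All (λ e → ∣ e ∣ ≡ r × e ∉ edges G) L
  × (∀ (e : Subset n) → ∣ e ∣ ≡ r → e ∉ edges G → e ∈ L)

WeaklySaturated : ∀ {r h n} → RGraph r h → RGraph r n → Set
WeaklySaturated H G =
  ∃ λ L → IsNonEdgeOrdering G L × Completes H (edges G) L

IsWsat : ∀ {r h} → ℕ → RGraph r h → ℕ → Set
IsWsat {r} n H m =
  (∃ λ (G : RGraph r n) → WeaklySaturated H G × ∥ G ∥ ≡ m)
  × (∀ (G : RGraph r n) → WeaklySaturated H G → m ≤ ∥ G ∥)

InExactlyOneEdge : ∀ {r h} → RGraph r h → Subset h → Set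
InExactlyOneEdge H W =
  ∃ λ f → f ∈ edges H × W ⊆ f × (∀ f′ → f′ ∈ edges H → W ⊆ f′ → f′ ≡ f)

IsSparseness : ∀ {r h} → RGraph r h → ℕ → Set
IsSparseness {h = h} H s =
  (∃ λ (W : Subset h) → InExactlyOneEdge H W × ∣ W ∣ ≡ s)
  × (∀ (W : Subset h) → InExactlyOneEdge H W → s ≤ ∣ W ∣)

-- Let W be a set of s vertices of H lying in exactly one edge f₀, and let G₀ be a
-- weakly H-saturated r-graph on k₁ vertices with wsat(k₁, H) edges. Add k₂ new
-- vertices, fix a core B of b = h − s old vertices, and let G consist of the edges
-- of G₀ together with all r-sets that meet a new vertex and have at most s − 1
-- vertices outside B. The non-edges of G₀ are added as in G₀; the remaining r-sets
-- e are added in order of increasing depth t = |e ∖ B| ≥ s. Embedding H with f₀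
-- onto e, W into e ∖ B and V(H) ∖ f₀ into B ∖ e (possible as h ≤ b + t) gives a
-- copy of H through e whose other edges miss a vertex of W, hence have depth < t
-- and are already present. Counting the added r-sets by how many of their vertices
-- lie in B, among the other old vertices and among the new ones gives at most
-- r h^r k₁^(s−2) k₂ of them. If k₁ < h − s the core is empty and every r-set
-- meeting a new vertex is added instead.

module Submission where

open import Defs
open import Data.Nat
  using (ℕ; zero; suc; _≤_; _<_; _+_; _*_; _^_; _∸_; z≤n; s≤s; _≟_; _≤?_; _<?_; >-nonZero)
open import Data.Nat.Properties
import Data.Bool as Bool
open import Data.Bool using (Bool; if_then_else_)
open import Data.Fin using (Fin; _↑ˡ_)
import Data.Fin.Properties as Finₚ
open import Data.Fin.Subset
  using (Subset; inside; outside; ∣_∣; _∈_; _∉_; _⊆_; _─_; _-_; _∩_; _∪_; ⁅_⁆; ⊤; ⊥; Nonempty)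
open import Data.Fin.Subset.Properties
open import Data.Vec using (_∷_; []; _++_; here; there; splitAt; take; drop)
open import Data.Vec.Properties
  using (zipWith-++; ≡-dec; ∷-injectiveʳ; ++-injectiveˡ; ++-injectiveʳ; take++drop≡id)
open import Data.Vec.Functional using () renaming (_∷_ to _◂_)
open import Data.List as List
  using (List; _∷_; []; [_]; _ʳ++_; length; cartesianProductWith; filter; deduplicate)
open import Data.List.Properties
  using (ʳ++-defn; length-++; length-map; length-filter; length-deduplicate)
open import Data.List.Membership.Propositional using () renaming (_∈_ to _∈ₗ_; _∉_ to _∉ₗ_)
open import Data.List.Membership.Propositional.Properties
  using (∈-++⁺ˡ; ∈-++⁺ʳ; ∈-++⁻; ∈-map⁺; ∈-map⁻; ∈-filter⁺; ∈-filter⁻;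
         ∈-deduplicate⁺; ∈-deduplicate⁻; ∈-cartesianProductWith⁺)
open import Data.List.Membership.DecPropositional using () renaming (_∈?_ to _∈ₗ?_)
open import Data.List.Relation.Binary.Subset.Propositional using () renaming (_⊆_ to _⊆ₗ_)
open import Data.List.Relation.Binary.Subset.Propositional.Properties using (∷⁺ʳ; xs⊆x∷xs)
open import Data.List.Relation.Unary.Any using (here; there)
import Data.List.Relation.Unary.Any.Properties as Any
import Data.List.Relation.Unary.All as All
open import Data.List.Relation.Unary.AllPairs using ([]; _∷_)
open import Data.List.Relation.Unary.Unique.Propositional using (Unique)
import Data.List.Relation.Unary.Unique.Propositional.Properties as Unique
open import Data.List.Relation.Unary.Unique.DecPropositional.Properties using (deduplicate-!)
open import Data.Product using (∃; _×_; _,_; proj₁; proj₂)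
open import Data.Sum using (_⊎_; inj₁; inj₂)
open import Function using (_∘_)
open import Function.Definitions using (Injective)
open import Relation.Nullary using (¬_; Dec; yes; no; does; contradiction)
open import Relation.Nullary.Decidable using (_×-dec_)
open import Relation.Unary using (Decidable)
open import Relation.Binary.PropositionalEquality hiding ([_])

private variable
  r h n : ℕ

_≟ₛ_ : (p q : Subset n) → Dec (p ≡ q)
_≟ₛ_ = ≡-dec Bool._≟_

∣p∣≡∣p─q∣+∣p∩q∣ : (p q : Subset n) → ∣ p ∣ ≡ ∣ p ─ q ∣ + ∣ p ∩ q ∣
∣p∣≡∣p─q∣+∣p∩q∣ []            []            = refl
∣p∣≡∣p─q∣+∣p∩q∣ (inside ∷ p)  (inside ∷ q)  = trans (cong suc (∣p∣≡∣p─q∣+∣p∩q∣ p q)) (sym (+-suc _ _))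
∣p∣≡∣p─q∣+∣p∩q∣ (inside ∷ p)  (outside ∷ q) = cong suc (∣p∣≡∣p─q∣+∣p∩q∣ p q)
∣p∣≡∣p─q∣+∣p∩q∣ (outside ∷ p) (inside ∷ q)  = ∣p∣≡∣p─q∣+∣p∩q∣ p q
∣p∣≡∣p─q∣+∣p∩q∣ (outside ∷ p) (outside ∷ q) = ∣p∣≡∣p─q∣+∣p∩q∣ p q

∣p∣+∣q─p∣≡∣p─q∣+∣q∣ : (p q : Subset n) → ∣ p ∣ + ∣ q ─ p ∣ ≡ ∣ p ─ q ∣ + ∣ q ∣
∣p∣+∣q─p∣≡∣p─q∣+∣q∣ []            []            = refl
∣p∣+∣q─p∣≡∣p─q∣+∣q∣ (inside ∷ p)  (inside ∷ q)  =
  trans (cong suc (∣p∣+∣q─p∣≡∣p─q∣+∣q∣ p q)) (sym (+-suc _ ∣ q ∣))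
∣p∣+∣q─p∣≡∣p─q∣+∣q∣ (inside ∷ p)  (outside ∷ q) = cong suc (∣p∣+∣q─p∣≡∣p─q∣+∣q∣ p q)
∣p∣+∣q─p∣≡∣p─q∣+∣q∣ (outside ∷ p) (inside ∷ q)  =
  trans (+-suc ∣ p ∣ _) (trans (cong suc (∣p∣+∣q─p∣≡∣p─q∣+∣q∣ p q)) (sym (+-suc _ ∣ q ∣)))
∣p∣+∣q─p∣≡∣p─q∣+∣q∣ (outside ∷ p) (outside ∷ q) = ∣p∣+∣q─p∣≡∣p─q∣+∣q∣ p q

q⊆p⇒∣p∣≡∣p─q∣+∣q∣ : {p q : Subset n} → q ⊆ p → ∣ p ∣ ≡ ∣ p ─ q ∣ + ∣ q ∣
q⊆p⇒∣p∣≡∣p─q∣+∣q∣ {p = p} {q} q⊆p = trans (∣p∣≡∣p─q∣+∣p∩q∣ p q) (cong (λ s → ∣ p ─ q ∣ + ∣ s ∣) p∩q≡q)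
  where
  p∩q≡q : p ∩ q ≡ q
  p∩q≡q = ⊆-antisym (p∩q⊆q p q) (λ x∈q → x∈p∩q⁺ (q⊆p x∈q , x∈q))

x∈p─q⇒x∉q : {p q : Subset n} {x : Fin n} → x ∈ p ─ q → x ∉ q
x∈p─q⇒x∉q {p = inside ∷ p} {outside ∷ q} here      ()
x∈p─q⇒x∉q {p = _ ∷ p}      {_ ∷ q}       (there x∈) (there x∈q) = x∈p─q⇒x∉q {p = p} x∈ x∈q

p⊆q∧∣q∣≤∣p∣⇒p≡q : {p q : Subset n} → p ⊆ q → ∣ q ∣ ≤ ∣ p ∣ → p ≡ q
p⊆q∧∣q∣≤∣p∣⇒p≡q {p = p} {q} p⊆q ∣q∣≤∣p∣ = ⊆-antisym p⊆q q⊆p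
  where
  q⊆p : q ⊆ p
  q⊆p {x} x∈q with x ∈? p
  ... | yes x∈p = x∈p
  ... | no  x∉p = contradiction ∣q∣≤∣p∣ (<⇒≱ (p⊂q⇒∣p∣<∣q∣ (p⊆q , x , x∈q , x∉p)))

p⊈q⇒Nonempty[p─q] : {p q : Subset n} → ¬ (p ⊆ q) → Nonempty (p ─ q)
p⊈q⇒Nonempty[p─q] {p = p} {q} p⊈q with nonempty? (p ─ q)
... | yes nonempty = nonempty
... | no  empty    = contradiction (λ {x} → p⊆q {x}) p⊈q
  where
  p⊆q : p ⊆ q
  p⊆q {x} x∈p with x ∈? q
  ... | yes x∈q = x∈q
  ... | no  x∉q = contradiction (x , x∈p∧x∉q⇒x∈p─q x∈p x∉q) empty

x∈p⇒∣p∣≡1+∣p-x∣ : {p : Subset n} {x : Fin n} → x ∈ p → ∣ p ∣ ≡ suc ∣ p - x ∣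
x∈p⇒∣p∣≡1+∣p-x∣ {p = p} {x} x∈p = begin
  ∣ p ∣                 ≡⟨ q⊆p⇒∣p∣≡∣p─q∣+∣q∣ (λ y∈⁅x⁆ → subst (_∈ p) (sym (x∈⁅y⁆⇒x≡y x y∈⁅x⁆)) x∈p) ⟩
  ∣ p - x ∣ + ∣ ⁅ x ⁆ ∣ ≡⟨ cong (∣ p - x ∣ +_) (∣⁅x⁆∣≡1 x) ⟩
  ∣ p - x ∣ + 1         ≡⟨ +-comm ∣ p - x ∣ 1 ⟩
  suc ∣ p - x ∣         ∎
  where open ≡-Reasoning

0<∣p∣⇒Nonempty : (p : Subset n) → 0 < ∣ p ∣ → Nonempty p
0<∣p∣⇒Nonempty (inside ∷ p)  _   = Fin.zero , here
0<∣p∣⇒Nonempty (outside ∷ p) 0<∣p∣ with 0<∣p∣⇒Nonempty p 0<∣p∣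
... | x , x∈p = Fin.suc x , there x∈p

∣p∣≡0⇒p≡⊥ : (p : Subset n) → ∣ p ∣ ≡ 0 → p ≡ ⊥
∣p∣≡0⇒p≡⊥ []            _   = refl
∣p∣≡0⇒p≡⊥ (outside ∷ p) ∣p∣≡0 = cong (outside ∷_) (∣p∣≡0⇒p≡⊥ p ∣p∣≡0)

x∉p⇒∣⁅x⁆∪p∣≡1+∣p∣ : (x : Fin n) (p : Subset n) → x ∉ p → ∣ ⁅ x ⁆ ∪ p ∣ ≡ suc ∣ p ∣
x∉p⇒∣⁅x⁆∪p∣≡1+∣p∣ Fin.zero    (inside ∷ p)  x∉p = contradiction here x∉p
x∉p⇒∣⁅x⁆∪p∣≡1+∣p∣ Fin.zero    (outside ∷ p) _   = cong (suc ∘ ∣_∣) (∪-identityˡ p)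
x∉p⇒∣⁅x⁆∪p∣≡1+∣p∣ (Fin.suc x) (inside ∷ p)  x∉p = cong suc (x∉p⇒∣⁅x⁆∪p∣≡1+∣p∣ x p (x∉p ∘ there))
x∉p⇒∣⁅x⁆∪p∣≡1+∣p∣ (Fin.suc x) (outside ∷ p) x∉p = x∉p⇒∣⁅x⁆∪p∣≡1+∣p∣ x p (x∉p ∘ there)

∣p++q∣≡∣p∣+∣q∣ : {m k : ℕ} (p : Subset m) (q : Subset k) → ∣ p ++ q ∣ ≡ ∣ p ∣ + ∣ q ∣
∣p++q∣≡∣p∣+∣q∣ []            q = refl
∣p++q∣≡∣p∣+∣q∣ (inside ∷ p)  q = cong suc (∣p++q∣≡∣p∣+∣q∣ p q)
∣p++q∣≡∣p∣+∣q∣ (outside ∷ p) q = ∣p++q∣≡∣p∣+∣q∣ p q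

⊥++⊥ : (m k : ℕ) → ⊥ {m} ++ ⊥ {k} ≡ ⊥
⊥++⊥ zero    k = refl
⊥++⊥ (suc m) k = cong (outside ∷_) (⊥++⊥ m k)

⁅x↑ˡ⁆≡⁅x⁆++⊥ : {m : ℕ} (x : Fin m) (k : ℕ) → ⁅ x ↑ˡ k ⁆ ≡ ⁅ x ⁆ ++ ⊥ {k}
⁅x↑ˡ⁆≡⁅x⁆++⊥ {suc m} Fin.zero k = cong (inside ∷_) (sym (⊥++⊥ m k))
⁅x↑ˡ⁆≡⁅x⁆++⊥ (Fin.suc x)      k = cong (outside ∷_) (⁅x↑ˡ⁆≡⁅x⁆++⊥ x k)

MapsTo : Subset h → Subset n → (Fin h → Fin n) → Set
MapsTo X Y φ = ∀ {x} → x ∈ X → φ x ∈ Y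

InjectiveOn : Subset h → (Fin h → Fin n) → Set
InjectiveOn X φ = ∀ {x y} → x ∈ X → y ∈ X → φ x ≡ φ y → x ≡ y

Embeds : Subset h → Subset n → (Fin h → Fin n) → Set
Embeds X Y φ = MapsTo X Y φ × InjectiveOn X φ

injectiveOn-∷ : {φ : Fin (suc h) → Fin n} {b : Bool} {X : Subset h} →
                InjectiveOn (b ∷ X) φ → InjectiveOn X (φ ∘ Fin.suc)
injectiveOn-∷ inj x∈ y∈ eq = Finₚ.suc-injective (inj (there x∈) (there y∈) eq)

∈-image⁺ : (φ : Fin h → Fin n) {X : Subset h} {x : Fin h} → x ∈ X → φ x ∈ image φ X
∈-image⁺ φ {inside ∷ X} here       = x∈p∪q⁺ (inj₁ (x∈⁅x⁆ (φ Fin.zero)))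
∈-image⁺ φ {b ∷ X}      (there x∈) =
  x∈p∪q⁺ {p = if b then ⁅ φ Fin.zero ⁆ else ⊥} (inj₂ (∈-image⁺ (φ ∘ Fin.suc) x∈))

∈-image⁻ : (φ : Fin h → Fin n) (X : Subset h) {y : Fin n} → y ∈ image φ X → ∃ λ x → x ∈ X × φ x ≡ y
∈-image⁻ φ []      y∈ = contradiction y∈ ∉⊥
∈-image⁻ φ (b ∷ X) y∈ with x∈p∪q⁻ (if b then ⁅ φ Fin.zero ⁆ else ⊥) (image (φ ∘ Fin.suc) X) y∈
∈-image⁻ φ (inside ∷ X)  y∈ | inj₁ y∈⁅⁆ = Fin.zero , here , sym (x∈⁅y⁆⇒x≡y _ y∈⁅⁆)
∈-image⁻ φ (outside ∷ X) y∈ | inj₁ y∈⊥ = contradiction y∈⊥ ∉⊥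
∈-image⁻ φ (b ∷ X)       y∈ | inj₂ y∈′ with ∈-image⁻ (φ ∘ Fin.suc) X y∈′
... | x , x∈X , φx≡y = Fin.suc x , there x∈X , φx≡y

image-⊆ : {φ : Fin h → Fin n} {X : Subset h} {Y : Subset n} → MapsTo X Y φ → image φ X ⊆ Y
image-⊆ {φ = φ} {X} maps y∈ with ∈-image⁻ φ X y∈
... | x , x∈X , refl = maps x∈X

∣image∣≡∣X∣ : (φ : Fin h → Fin n) (X : Subset h) → InjectiveOn X φ → ∣ image φ X ∣ ≡ ∣ X ∣
∣image∣≡∣X∣ {n = n} φ [] _ = ∣⊥∣≡0 n
∣image∣≡∣X∣ φ (outside ∷ X) inj =
  trans (cong ∣_∣ (∪-identityˡ (image (φ ∘ Fin.suc) X)))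
        (∣image∣≡∣X∣ (φ ∘ Fin.suc) X (injectiveOn-∷ inj))
∣image∣≡∣X∣ φ (inside ∷ X) inj =
  trans (x∉p⇒∣⁅x⁆∪p∣≡1+∣p∣ (φ Fin.zero) _ φ0∉)
        (cong suc (∣image∣≡∣X∣ (φ ∘ Fin.suc) X (injectiveOn-∷ inj)))
  where
  φ0∉ : φ Fin.zero ∉ image (φ ∘ Fin.suc) X
  φ0∉ φ0∈ with ∈-image⁻ (φ ∘ Fin.suc) X φ0∈
  ... | x , x∈X , eq with inj (there x∈X) here eq
  ... | ()

image-↑ˡ : {m : ℕ} (k : ℕ) (φ : Fin h → Fin m) (X : Subset h) →
           image (λ i → φ i ↑ˡ k) X ≡ image φ X ++ ⊥ {k}
image-↑ˡ {m = m} k φ []      = sym (⊥++⊥ m k)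
image-↑ˡ {m = m} k φ (b ∷ X) = begin
  (if b then ⁅ φ Fin.zero ↑ˡ k ⁆ else ⊥) ∪ image (λ i → φ (Fin.suc i) ↑ˡ k) X
    ≡⟨ cong₂ _∪_ (head b) (image-↑ˡ k (φ ∘ Fin.suc) X) ⟩
  ((if b then ⁅ φ Fin.zero ⁆ else ⊥) ++ ⊥) ∪ (image (φ ∘ Fin.suc) X ++ ⊥)
    ≡⟨ zipWith-++ _ (if b then ⁅ φ Fin.zero ⁆ else ⊥) ⊥ (image (φ ∘ Fin.suc) X) ⊥ ⟩
  ((if b then ⁅ φ Fin.zero ⁆ else ⊥) ∪ image (φ ∘ Fin.suc) X) ++ (⊥ ∪ ⊥)
    ≡⟨ cong (image φ (b ∷ X) ++_) (∪-identityˡ ⊥) ⟩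
  image φ (b ∷ X) ++ ⊥ ∎
  where
  open ≡-Reasoning
  head : ∀ b → (if b then ⁅ φ Fin.zero ↑ˡ k ⁆ else ⊥) ≡ (if b then ⁅ φ Fin.zero ⁆ else ⊥) ++ ⊥ {k}
  head inside  = ⁅x↑ˡ⁆≡⁅x⁆++⊥ (φ Fin.zero) k
  head outside = sym (⊥++⊥ m k)

-- The vertex d is only the value taken outside X.
embed : Fin n → (X : Subset h) (Y : Subset n) → ∣ X ∣ ≤ ∣ Y ∣ → ∃ (Embeds X Y)
embed d [] Y _ = (λ ()) , (λ ()) , λ ()
embed d (outside ∷ X) Y ∣X∣≤∣Y∣ with embed d X Y ∣X∣≤∣Y∣
... | φ , maps , inj =
  d ◂ φ , (λ { (there x∈) → maps x∈ }) , λ { (there x∈) (there y∈) eq → cong Fin.suc (inj x∈ y∈ eq) }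
embed d (inside ∷ X) Y ∣X∣<∣Y∣ with 0<∣p∣⇒Nonempty Y (≤-trans (s≤s z≤n) ∣X∣<∣Y∣)
... | y , y∈Y with embed d X (Y - y) (≤-pred (subst (suc ∣ X ∣ ≤_) (x∈p⇒∣p∣≡1+∣p-x∣ y∈Y) ∣X∣<∣Y∣))
... | φ , maps , inj = y ◂ φ , maps′ , inj′
  where
  φx∉⁅y⁆ : ∀ {x} → x ∈ X → φ x ∉ ⁅ y ⁆
  φx∉⁅y⁆ x∈X = x∈p─q⇒x∉q {p = Y} (maps x∈X)
  maps′ : MapsTo (inside ∷ X) Y (y ◂ φ)
  maps′ here        = y∈Y
  maps′ (there x∈X) = p─q⊆p Y ⁅ y ⁆ (maps x∈X)
  inj′ : InjectiveOn (inside ∷ X) (y ◂ φ)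
  inj′ here        here        _  = refl
  inj′ here        (there x∈X) eq = contradiction (subst (_∈ ⁅ y ⁆) eq (x∈⁅x⁆ y)) (φx∉⁅y⁆ x∈X)
  inj′ (there x∈X) here        eq = contradiction (subst (_∈ ⁅ y ⁆) (sym eq) (x∈⁅x⁆ y)) (φx∉⁅y⁆ x∈X)
  inj′ (there x∈X) (there z∈X) eq = cong Fin.suc (inj x∈X z∈X eq)

piecewise : Subset h → (Fin h → Fin n) → (Fin h → Fin n) → Fin h → Fin n
piecewise X₁ φ₁ φ₂ x = if does (x ∈? X₁) then φ₁ x else φ₂ x

module _ {X₁ : Subset h} (φ₁ φ₂ : Fin h → Fin n) where

  piecewise-∈ : ∀ {x} → x ∈ X₁ → piecewise X₁ φ₁ φ₂ x ≡ φ₁ x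
  piecewise-∈ {x} x∈X₁ with x ∈? X₁
  ... | yes _   = refl
  ... | no x∉X₁ = contradiction x∈X₁ x∉X₁

  piecewise-∉ : ∀ {x} → x ∉ X₁ → piecewise X₁ φ₁ φ₂ x ≡ φ₂ x
  piecewise-∉ {x} x∉X₁ with x ∈? X₁
  ... | yes x∈X₁ = contradiction x∈X₁ x∉X₁
  ... | no _     = refl

  piecewise-embeds : {X : Subset h} {Y₁ Y₂ : Subset n} →
                     Embeds X₁ Y₁ φ₁ → Embeds (X ─ X₁) Y₂ φ₂ → (∀ {y} → y ∈ Y₁ → y ∉ Y₂) →
                     Embeds X (Y₁ ∪ Y₂) (piecewise X₁ φ₁ φ₂)
  piecewise-embeds {X} {Y₁} {Y₂} (maps₁ , inj₁′) (maps₂ , inj₂′) Y₁∩Y₂≡∅ = maps , inj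
    where
    φ = piecewise X₁ φ₁ φ₂
    Side : Fin h → Set
    Side x = (x ∈ X₁ × φ x ≡ φ₁ x) ⊎ (x ∈ X ─ X₁ × φ x ≡ φ₂ x)
    side : ∀ {x} → x ∈ X → Side x
    side {x} x∈X with x ∈? X₁
    ... | yes x∈X₁ = inj₁ (x∈X₁ , refl)
    ... | no  x∉X₁ = inj₂ (x∈p∧x∉q⇒x∈p─q x∈X x∉X₁ , refl)
    maps : MapsTo X (Y₁ ∪ Y₂) φ
    maps x∈X with side x∈X
    ... | inj₁ (x∈X₁ , eq) = x∈p∪q⁺ (inj₁ (subst (_∈ Y₁) (sym eq) (maps₁ x∈X₁)))
    ... | inj₂ (x∈X₂ , eq) = x∈p∪q⁺ (inj₂ (subst (_∈ Y₂) (sym eq) (maps₂ x∈X₂)))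
    inj : InjectiveOn X φ
    inj x∈X y∈X φx≡φy with side x∈X | side y∈X
    ... | inj₁ (x∈ , ex) | inj₁ (y∈ , ey) = inj₁′ x∈ y∈ (trans (sym ex) (trans φx≡φy ey))
    ... | inj₂ (x∈ , ex) | inj₂ (y∈ , ey) = inj₂′ x∈ y∈ (trans (sym ex) (trans φx≡φy ey))
    ... | inj₁ (x∈ , ex) | inj₂ (y∈ , ey) =
      contradiction (maps₂ y∈) (Y₁∩Y₂≡∅ (subst (_∈ Y₁) (trans (sym ex) (trans φx≡φy ey)) (maps₁ x∈)))
    ... | inj₂ (x∈ , ex) | inj₁ (y∈ , ey) =
      contradiction (maps₂ x∈)
                    (Y₁∩Y₂≡∅ (subst (_∈ Y₁) (trans (sym ey) (trans (sym φx≡φy) ex)) (maps₁ y∈)))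

copyEmbedding : Fin n → {A W : Subset h} {e D Z : Subset n} →
                W ⊆ A → D ⊆ e → (∀ {z} → z ∈ Z → z ∉ e) →
                ∣ A ∣ ≡ ∣ e ∣ → ∣ W ∣ ≤ ∣ D ∣ → ∣ ⊤ ─ A ∣ ≤ ∣ Z ∣ →
                ∃ λ φ → Injective _≡_ _≡_ φ × image φ A ≡ e × MapsTo W D φ × MapsTo (⊤ ─ A) Z φ
copyEmbedding d {A} {W} {e} {D} {Z} W⊆A D⊆e Z∩e≡∅ ∣A∣≡∣e∣ ∣W∣≤∣D∣ ∣⊤─A∣≤∣Z∣ =
  φ , (λ eq → proj₂ embeds ∈⊤ ∈⊤ eq) , image-A , maps-W , maps-⊤─A
  where
  φ₁ = proj₁ (embed d W D ∣W∣≤∣D∣)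
  embeds₁ = proj₂ (embed d W D ∣W∣≤∣D∣)
  I₁ = image φ₁ W
  I₁⊆e : I₁ ⊆ e
  I₁⊆e = D⊆e ∘ image-⊆ (proj₁ embeds₁)
  ∣A─W∣≡∣e─I₁∣ : ∣ A ─ W ∣ ≡ ∣ e ─ I₁ ∣
  ∣A─W∣≡∣e─I₁∣ = +-cancelʳ-≡ ∣ W ∣ _ _ (begin
    ∣ A ─ W ∣ + ∣ W ∣  ≡⟨ sym (q⊆p⇒∣p∣≡∣p─q∣+∣q∣ W⊆A) ⟩
    ∣ A ∣              ≡⟨ ∣A∣≡∣e∣ ⟩
    ∣ e ∣              ≡⟨ q⊆p⇒∣p∣≡∣p─q∣+∣q∣ I₁⊆e ⟩
    ∣ e ─ I₁ ∣ + ∣ I₁ ∣ ≡⟨ cong (∣ e ─ I₁ ∣ +_) (∣image∣≡∣X∣ φ₁ W (proj₂ embeds₁)) ⟩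
    ∣ e ─ I₁ ∣ + ∣ W ∣ ∎)
    where open ≡-Reasoning
  φ₂ = proj₁ (embed d (A ─ W) (e ─ I₁) (≤-reflexive ∣A─W∣≡∣e─I₁∣))
  embeds₂ = proj₂ (embed d (A ─ W) (e ─ I₁) (≤-reflexive ∣A─W∣≡∣e─I₁∣))
  φ₁₂ = piecewise W φ₁ φ₂
  embeds₁₂ : Embeds A (I₁ ∪ (e ─ I₁)) φ₁₂
  embeds₁₂ = piecewise-embeds φ₁ φ₂ (∈-image⁺ φ₁ , proj₂ embeds₁) embeds₂
               λ y∈I₁ y∈e─I₁ → x∈p─q⇒x∉q {p = e} y∈e─I₁ y∈I₁
  I₁∪e─I₁⊆e : I₁ ∪ (e ─ I₁) ⊆ e
  I₁∪e─I₁⊆e y∈ with x∈p∪q⁻ I₁ (e ─ I₁) y∈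
  ... | inj₁ y∈I₁   = I₁⊆e y∈I₁
  ... | inj₂ y∈e─I₁ = p─q⊆p e I₁ y∈e─I₁
  φ₃ = proj₁ (embed d (⊤ ─ A) Z ∣⊤─A∣≤∣Z∣)
  embeds₃ = proj₂ (embed d (⊤ ─ A) Z ∣⊤─A∣≤∣Z∣)
  φ = piecewise A φ₁₂ φ₃
  embeds : Embeds ⊤ ((I₁ ∪ (e ─ I₁)) ∪ Z) φ
  embeds = piecewise-embeds φ₁₂ φ₃ embeds₁₂ embeds₃ λ y∈ y∈Z → Z∩e≡∅ y∈Z (I₁∪e─I₁⊆e y∈)
  maps-A : MapsTo A e φ
  maps-A x∈A = subst (_∈ e) (sym (piecewise-∈ φ₁₂ φ₃ x∈A)) (I₁∪e─I₁⊆e (proj₁ embeds₁₂ x∈A))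
  image-A : image φ A ≡ e
  image-A = p⊆q∧∣q∣≤∣p∣⇒p≡q (image-⊆ maps-A)
    (≤-reflexive (trans (sym ∣A∣≡∣e∣) (sym (∣image∣≡∣X∣ φ A λ x∈ y∈ → proj₂ embeds ∈⊤ ∈⊤))))
  maps-W : MapsTo W D φ
  maps-W w∈W = subst (_∈ D) (sym (trans (piecewise-∈ φ₁₂ φ₃ (W⊆A w∈W)) (piecewise-∈ φ₁ φ₂ w∈W)))
                     (proj₁ embeds₁ w∈W)
  maps-⊤─A : MapsTo (⊤ ─ A) Z φ
  maps-⊤─A x∈ = subst (_∈ Z) (sym (piecewise-∉ φ₁₂ φ₃ (x∈p─q⇒x∉q {p = ⊤} x∈))) (proj₁ embeds₃ x∈)

-- A copy of H through a deep r-set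

copyContaining-fromShallower :
  (H : RGraph r h) {W : Subset h} → InExactlyOneEdge H W →
  (B : Subset n) (E : List (Subset n)) {e : Subset n} →
  ∣ e ∣ ≡ r → 0 < ∣ e ─ B ∣ → ∣ W ∣ ≤ ∣ e ─ B ∣ → h ≤ ∣ B ∣ + ∣ e ─ B ∣ →
  (∀ I → ∣ I ∣ ≡ r → ∣ I ─ B ∣ < ∣ e ─ B ∣ → I ∈ₗ E) →
  CopyContaining H (e ∷ E) e
copyContaining-fromShallower {r} {h} H {W} (f₀ , f₀∈H , W⊆f₀ , W-only-in-f₀) B E {e}
                             ∣e∣≡r 0<∣e─B∣ ∣W∣≤∣e─B∣ h≤∣B∣+∣e─B∣ shallower∈E =
  φ , φ-injective , All.tabulate edge↦ , f₀ , f₀∈H , image-f₀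
  where
  ∣f₀∣≡r : ∣ f₀ ∣ ≡ r
  ∣f₀∣≡r = All.lookup (uniform H) f₀∈H
  ∣⊤─f₀∣≤∣B─e∣ : ∣ ⊤ ─ f₀ ∣ ≤ ∣ B ─ e ∣
  ∣⊤─f₀∣≤∣B─e∣ = +-cancelʳ-≤ r _ _ (begin
    ∣ ⊤ ─ f₀ ∣ + r       ≡⟨ cong (∣ ⊤ ─ f₀ ∣ +_) (sym ∣f₀∣≡r) ⟩
    ∣ ⊤ ─ f₀ ∣ + ∣ f₀ ∣  ≡⟨ sym (q⊆p⇒∣p∣≡∣p─q∣+∣q∣ {p = ⊤} {f₀} ⊆⊤) ⟩
    ∣ ⊤ {h} ∣            ≡⟨ ∣⊤∣≡n h ⟩
    h                    ≤⟨ h≤∣B∣+∣e─B∣ ⟩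
    ∣ B ∣ + ∣ e ─ B ∣    ≡⟨ ∣p∣+∣q─p∣≡∣p─q∣+∣q∣ B e ⟩
    ∣ B ─ e ∣ + ∣ e ∣    ≡⟨ cong (∣ B ─ e ∣ +_) ∣e∣≡r ⟩
    ∣ B ─ e ∣ + r        ∎)
    where open ≤-Reasoning
  embedding = copyEmbedding (proj₁ (0<∣p∣⇒Nonempty (e ─ B) 0<∣e─B∣)) W⊆f₀ (p─q⊆p e B)
                (x∈p─q⇒x∉q {p = B}) (trans ∣f₀∣≡r (sym ∣e∣≡r)) ∣W∣≤∣e─B∣ ∣⊤─f₀∣≤∣B─e∣
  φ = proj₁ embedding
  φ-injective = proj₁ (proj₂ embedding)
  image-f₀ = proj₁ (proj₂ (proj₂ embedding))
  maps-W = proj₁ (proj₂ (proj₂ (proj₂ embedding)))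
  maps-⊤─f₀ = proj₂ (proj₂ (proj₂ (proj₂ embedding)))
  φx∈e─B : ∀ x → Dec (x ∈ f₀) → φ x ∉ B → φ x ∈ e ─ B
  φx∈e─B x (yes x∈f₀) φx∉B = x∈p∧x∉q⇒x∈p─q (subst (φ x ∈_) image-f₀ (∈-image⁺ φ x∈f₀)) φx∉B
  φx∈e─B x (no  x∉f₀) φx∉B = contradiction (p─q⊆p B e (maps-⊤─f₀ (x∈p∧x∉q⇒x∈p─q ∈⊤ x∉f₀))) φx∉B
  edge↦ : ∀ {f} → f ∈ₗ edges H → image φ f ∈ₗ e ∷ E
  edge↦ {f} f∈H with f ≟ₛ f₀
  ... | yes refl = here image-f₀
  ... | no f≢f₀  = there (shallower∈E I ∣I∣≡r (p⊂q⇒∣p∣<∣q∣ (I─B⊆e─B , φ w , maps-W w∈W , φw∉I─B)))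
    where
    I = image φ f
    ∣I∣≡r : ∣ I ∣ ≡ r
    ∣I∣≡r = trans (∣image∣≡∣X∣ φ f λ _ _ → φ-injective) (All.lookup (uniform H) f∈H)
    I─B⊆e─B : I ─ B ⊆ e ─ B
    I─B⊆e─B y∈I─B with ∈-image⁻ φ f (p─q⊆p I B y∈I─B)
    ... | x , x∈f , refl = φx∈e─B x (x ∈? f₀) (x∈p─q⇒x∉q {p = I} y∈I─B)
    witness = p⊈q⇒Nonempty[p─q] λ W⊆f → f≢f₀ (W-only-in-f₀ f f∈H W⊆f)
    w = proj₁ witness
    w∈W─f = proj₂ witness
    w∈W = p─q⊆p W f w∈W─f
    φw∉I─B : φ w ∉ I ─ B
    φw∉I─B φw∈I─B with ∈-image⁻ φ f (p─q⊆p I B φw∈I─B)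
    ... | x , x∈f , φx≡φw = x∈p─q⇒x∉q {p = W} w∈W─f (subst (_∈ f) (φ-injective φx≡φw) x∈f)

∈-ʳ++⁺ˡ : {A E : List (Subset n)} {x : Subset n} → x ∈ₗ A → x ∈ₗ A ʳ++ E
∈-ʳ++⁺ˡ {A = A} x∈A = subst (_ ∈ₗ_) (sym (ʳ++-defn A)) (∈-++⁺ˡ (Any.reverse⁺ x∈A))

∈-ʳ++⁺ʳ : (A : List (Subset n)) {E : List (Subset n)} {x : Subset n} → x ∈ₗ E → x ∈ₗ A ʳ++ E
∈-ʳ++⁺ʳ A x∈E = subst (_ ∈ₗ_) (sym (ʳ++-defn A)) (∈-++⁺ʳ (List.reverse A) x∈E)

module _ (H : RGraph r h) where

  copyContaining-mono : {E E′ : List (Subset n)} {e : Subset n} →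
                        E ⊆ₗ E′ → CopyContaining H E e → CopyContaining H E′ e
  copyContaining-mono E⊆E′ (φ , injective , edges↦ , copy-of-e) =
    φ , injective , All.map E⊆E′ edges↦ , copy-of-e

  completes-mono : {E E′ : List (Subset n)} (L : List (Subset n)) →
                   E ⊆ₗ E′ → Completes H E L → Completes H E′ L
  completes-mono []      E⊆E′ _                  = _
  completes-mono (e ∷ L) E⊆E′ (copy , completes) =
    copyContaining-mono (∷⁺ʳ e E⊆E′) copy , completes-mono L (∷⁺ʳ e E⊆E′) completes

  completes-++ : (E A : List (Subset n)) {L : List (Subset n)} →
                 Completes H E A → Completes H (A ʳ++ E) L → Completes H E (A List.++ L)
  completes-++ E []      _                  completes-L = completes-L
  completes-++ E (e ∷ A) (copy , completes-A) completes-L =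
    copy , completes-++ (e ∷ E) A completes-A completes-L

  completes-independently : {E E′ : List (Subset n)} (L : List (Subset n)) →
                            (∀ {e} → e ∈ₗ L → CopyContaining H (e ∷ E) e) → E ⊆ₗ E′ →
                            Completes H E′ L
  completes-independently []      _    _    = _
  completes-independently (e ∷ L) copy E⊆E′ =
    copyContaining-mono (∷⁺ʳ e E⊆E′) (copy (here refl)) ,
    completes-independently L (copy ∘ there) (xs⊆x∷xs _ e ∘ E⊆E′)

lift : {m : ℕ} (k : ℕ) → Subset m → Subset (m + k)
lift k p = p ++ ⊥ {k}

∣lift∣≡∣p∣ : {m : ℕ} (k : ℕ) (p : Subset m) → ∣ lift k p ∣ ≡ ∣ p ∣
∣lift∣≡∣p∣ k p = trans (∣p++q∣≡∣p∣+∣q∣ p ⊥) (trans (cong (∣ p ∣ +_) (∣⊥∣≡0 k)) (+-identityʳ ∣ p ∣))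

lift-injective : {m : ℕ} (k : ℕ) {p q : Subset m} → lift k p ≡ lift k q → p ≡ q
lift-injective k {p} {q} = ++-injectiveˡ p q

module _ {m : ℕ} (k : ℕ) (H : RGraph r h) where

  copyContaining-lift : {E : List (Subset m)} {e : Subset m} →
                        CopyContaining H E e → CopyContaining H (List.map (lift k) E) (lift k e)
  copyContaining-lift (φ , injective , edges↦ , f , f∈H , φf≡e) =
    (λ i → φ i ↑ˡ k) ,
    (λ eq → injective (Finₚ.↑ˡ-injective k _ _ eq)) ,
    All.map (λ {f} φf∈E → subst (_∈ₗ _) (sym (image-↑ˡ k φ f)) (∈-map⁺ (lift k) φf∈E)) edges↦ ,
    f , f∈H , trans (image-↑ˡ k φ f) (cong (lift k) φf≡e)

  completes-lift : (E L : List (Subset m)) → Completes H E L →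
                   Completes H (List.map (lift k) E) (List.map (lift k) L)
  completes-lift E []      _                  = _
  completes-lift E (e ∷ L) (copy , completes) =
    copyContaining-lift copy , completes-lift (e ∷ E) L completes

subsetsOfSize : (n k : ℕ) → List (Subset n)
subsetsOfSize zero    zero    = [ [] ]
subsetsOfSize zero    (suc k) = []
subsetsOfSize (suc n) zero    = List.map (outside ∷_) (subsetsOfSize n zero)
subsetsOfSize (suc n) (suc k) =
  List.map (inside ∷_) (subsetsOfSize n k) List.++ List.map (outside ∷_) (subsetsOfSize n (suc k))

∈-subsetsOfSize⁺ : {k : ℕ} (x : Subset n) → ∣ x ∣ ≡ k → x ∈ₗ subsetsOfSize n k
∈-subsetsOfSize⁺ {k = zero}  []            _     = here refl
∈-subsetsOfSize⁺ {k = suc k} (inside ∷ x)  ∣x∣≡k =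
  ∈-++⁺ˡ (∈-map⁺ (inside ∷_) (∈-subsetsOfSize⁺ x (suc-injective ∣x∣≡k)))
∈-subsetsOfSize⁺ {k = zero}  (outside ∷ x) ∣x∣≡k = ∈-map⁺ (outside ∷_) (∈-subsetsOfSize⁺ x ∣x∣≡k)
∈-subsetsOfSize⁺ {k = suc k} (outside ∷ x) ∣x∣≡k =
  ∈-++⁺ʳ (List.map (inside ∷_) _) (∈-map⁺ (outside ∷_) (∈-subsetsOfSize⁺ x ∣x∣≡k))

∈-subsetsOfSize⁻ : (n k : ℕ) {x : Subset n} → x ∈ₗ subsetsOfSize n k → ∣ x ∣ ≡ k
∈-subsetsOfSize⁻ zero    zero    (here refl) = refl
∈-subsetsOfSize⁻ (suc n) zero    x∈ with ∈-map⁻ (outside ∷_) x∈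
... | y , y∈ , refl = ∈-subsetsOfSize⁻ n zero y∈
∈-subsetsOfSize⁻ (suc n) (suc k) x∈ with ∈-++⁻ (List.map (inside ∷_) (subsetsOfSize n k)) x∈
... | inj₁ x∈ins with ∈-map⁻ (inside ∷_) x∈ins
...   | y , y∈ , refl = cong suc (∈-subsetsOfSize⁻ n k y∈)
∈-subsetsOfSize⁻ (suc n) (suc k) x∈ | inj₂ x∈outs with ∈-map⁻ (outside ∷_) x∈outs
...   | y , y∈ , refl = ∈-subsetsOfSize⁻ n (suc k) y∈

subsetsOfSize-unique : (n k : ℕ) → Unique (subsetsOfSize n k)
subsetsOfSize-unique zero    zero    = All.[] ∷ []
subsetsOfSize-unique zero    (suc k) = []
subsetsOfSize-unique (suc n) zero    = Unique.map⁺ ∷-injectiveʳ (subsetsOfSize-unique n zero)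
subsetsOfSize-unique (suc n) (suc k) =
  Unique.++⁺ (Unique.map⁺ ∷-injectiveʳ (subsetsOfSize-unique n k))
             (Unique.map⁺ ∷-injectiveʳ (subsetsOfSize-unique n (suc k)))
             disjoint
  where
  disjoint : ∀ {x} → ¬ (x ∈ₗ List.map (inside ∷_) (subsetsOfSize n k) ×
                         x ∈ₗ List.map (outside ∷_) (subsetsOfSize n (suc k)))
  disjoint (x∈ins , x∈outs) with ∈-map⁻ (inside ∷_) x∈ins | ∈-map⁻ (outside ∷_) x∈outs
  ... | _ , _ , refl | _ , _ , ()

length-subsetsOfSize : (n k : ℕ) → length (subsetsOfSize n k) ≤ n ^ k
length-subsetsOfSize zero    zero    = ≤-refl
length-subsetsOfSize zero    (suc k) = z≤n
length-subsetsOfSize (suc n) zero    =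
  ≤-trans (≤-reflexive (length-map (outside ∷_) (subsetsOfSize n zero))) (length-subsetsOfSize n zero)
length-subsetsOfSize (suc n) (suc k) = begin
  length (List.map (inside ∷_) ins List.++ List.map (outside ∷_) outs)
    ≡⟨ length-++ (List.map (inside ∷_) ins) ⟩
  length (List.map (inside ∷_) ins) + length (List.map (outside ∷_) outs)
    ≡⟨ cong₂ _+_ (length-map (inside ∷_) ins) (length-map (outside ∷_) outs) ⟩
  length ins + length outs
    ≤⟨ +-mono-≤ (length-subsetsOfSize n k) (length-subsetsOfSize n (suc k)) ⟩
  n ^ k + n * n ^ k
    ≤⟨ +-mono-≤ (^-monoˡ-≤ k (n≤1+n n)) (*-monoʳ-≤ n (^-monoˡ-≤ k (n≤1+n n))) ⟩
  suc n ^ k + n * suc n ^ k ∎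
  where
  open ≤-Reasoning
  ins = subsetsOfSize n k
  outs = subsetsOfSize n (suc k)

infixr 6 _⊗_
_⊗_ : {m k : ℕ} → List (Subset m) → List (Subset k) → List (Subset (m + k))
_⊗_ = cartesianProductWith _++_

length-⊗ : {m k : ℕ} (xs : List (Subset m)) (ys : List (Subset k)) →
           length (xs ⊗ ys) ≡ length xs * length ys
length-⊗ []       ys = refl
length-⊗ (x ∷ xs) ys = begin
  length (List.map (x ++_) ys List.++ xs ⊗ ys)    ≡⟨ length-++ (List.map (x ++_) ys) ⟩
  length (List.map (x ++_) ys) + length (xs ⊗ ys) ≡⟨ cong₂ _+_ (length-map (x ++_) ys) (length-⊗ xs ys) ⟩
  length ys + length xs * length ys               ∎
  where open ≡-Reasoning

⋃₁ : {A : Set} → ℕ → (ℕ → List A) → List A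
⋃₁ zero    f = []
⋃₁ (suc n) f = f (suc n) List.++ ⋃₁ n f

∈-⋃₁⁺ : {A : Set} {f : ℕ → List A} {x : A} {i : ℕ} (n : ℕ) → 1 ≤ i → i ≤ n → x ∈ₗ f i → x ∈ₗ ⋃₁ n f
∈-⋃₁⁺ {i = i} (suc n) 1≤i i≤1+n x∈fi with i ≟ suc n
... | yes refl = ∈-++⁺ˡ x∈fi
... | no  i≢1+n = ∈-++⁺ʳ _ (∈-⋃₁⁺ n 1≤i (≤-pred (≤∧≢⇒< i≤1+n i≢1+n)) x∈fi)
∈-⋃₁⁺ {i = suc i} zero _ () _

length-⋃₁ : {A : Set} {f : ℕ → List A} {K : ℕ} (n : ℕ) →
            (∀ i → 1 ≤ i → i ≤ n → length (f i) ≤ K) → length (⋃₁ n f) ≤ n * K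
length-⋃₁         zero    _     = z≤n
length-⋃₁ {f = f} (suc n) bound =
  ≤-trans (≤-reflexive (length-++ (f (suc n))))
          (+-mono-≤ (bound (suc n) (s≤s z≤n) ≤-refl)
                    (length-⋃₁ n λ i 1≤i i≤n → bound i 1≤i (m≤n⇒m≤1+n i≤n)))

c^[m∸j]*k^j≤K^[m∸1]*k : {c k K : ℕ} (m j : ℕ) → c ≤ K → k ≤ K → 1 ≤ j → j ≤ m →
                        c ^ (m ∸ j) * k ^ j ≤ K ^ (m ∸ 1) * k
c^[m∸j]*k^j≤K^[m∸1]*k {c} {k} {K} (suc m) (suc j) c≤K k≤K _ (s≤s j≤m) = begin
  c ^ (m ∸ j) * (k * k ^ j)    ≤⟨ *-mono-≤ (^-monoˡ-≤ (m ∸ j) c≤K) (*-monoʳ-≤ k (^-monoˡ-≤ j k≤K)) ⟩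
  K ^ (m ∸ j) * (k * K ^ j)    ≡⟨ cong (K ^ (m ∸ j) *_) (*-comm k (K ^ j)) ⟩
  K ^ (m ∸ j) * (K ^ j * k)    ≡⟨ sym (*-assoc (K ^ (m ∸ j)) (K ^ j) k) ⟩
  K ^ (m ∸ j) * K ^ j * k      ≡⟨ cong (_* k) (sym (^-distribˡ-+-* K (m ∸ j) j)) ⟩
  K ^ (m ∸ j + j) * k          ≡⟨ cong (λ e → K ^ e * k) (m∸n+n≡m j≤m) ⟩
  K ^ m * k                    ∎
  where open ≤-Reasoning

a*h^[r∸m]≤h^r : {a h : ℕ} (r m : ℕ) → a ≤ h → 1 ≤ m → m ≤ r → a * h ^ (r ∸ m) ≤ h ^ r
a*h^[r∸m]≤h^r {h = zero}  r       m       z≤n _ _          = z≤n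
a*h^[r∸m]≤h^r {a} {suc h} (suc r) (suc m) a≤h _ (s≤s m≤r) = begin
  a * suc h ^ (r ∸ m)      ≤⟨ *-monoˡ-≤ (suc h ^ (r ∸ m)) a≤h ⟩
  suc h ^ suc (r ∸ m)      ≤⟨ ^-monoʳ-≤ (suc h) (s≤s (m∸n≤m r m)) ⟩
  suc h ^ suc r            ∎
  where open ≤-Reasoning

r∸1≡[r∸[s∸1]]+[s∸2] : {r s : ℕ} → 2 ≤ s → s ≤ r → r ∸ 1 ≡ r ∸ (s ∸ 1) + (s ∸ 2)
r∸1≡[r∸[s∸1]]+[s∸2] {suc (suc r)} {suc (suc s)} (s≤s (s≤s z≤n)) (s≤s (s≤s s≤r)) =
  sym (m∸n+n≡m (m≤n⇒m≤1+n s≤r))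

m*b^[r∸m]*K^[m∸1]≤h^r*K^[s∸2] : {b h K r s : ℕ} (m : ℕ) →
  b ≤ h → 1 ≤ K → s ≤ r → r ≤ h → 1 ≤ m → m ≤ s ∸ 1 →
  m * (b ^ (r ∸ m) * K ^ (m ∸ 1)) ≤ h ^ r * K ^ (s ∸ 2)
m*b^[r∸m]*K^[m∸1]≤h^r*K^[s∸2] {b} {h} {K} {r} {s} m b≤h 1≤K s≤r r≤h 1≤m m≤s∸1 = begin
  m * (b ^ (r ∸ m) * K ^ (m ∸ 1))  ≡⟨ *-assoc m (b ^ (r ∸ m)) (K ^ (m ∸ 1)) ⟨
  m * b ^ (r ∸ m) * K ^ (m ∸ 1)    ≤⟨ *-mono-≤ (*-monoʳ-≤ m (^-monoˡ-≤ (r ∸ m) b≤h))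
                                               (^-monoʳ-≤ K {{>-nonZero 1≤K}} m∸1≤s∸2) ⟩
  m * h ^ (r ∸ m) * K ^ (s ∸ 2)    ≤⟨ *-monoˡ-≤ (K ^ (s ∸ 2)) (a*h^[r∸m]≤h^r r m (≤-trans m≤r r≤h) 1≤m m≤r) ⟩
  h ^ r * K ^ (s ∸ 2)              ∎
  where
  open ≤-Reasoning
  m≤r : m ≤ r
  m≤r = ≤-trans m≤s∸1 (≤-trans (m∸n≤m s 1) s≤r)
  m∸1≤s∸2 : m ∸ 1 ≤ s ∸ 2
  m∸1≤s∸2 = subst (m ∸ 1 ≤_) (∸-+-assoc s 1 1) (∸-monoˡ-≤ 1 m≤s∸1)

0<e⇒0^e*x≡0 : (e x : ℕ) → 0 < e → 0 ^ e * x ≡ 0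
0<e⇒0^e*x≡0 (suc e) x _ = refl

m*0^[r∸m]*K^[m∸1]≤h^r*K^[s∸2] : {h K r s : ℕ} (m : ℕ) →
  K ≤ h → 2 ≤ s → s ≤ r → r ≤ h → m ≤ r →
  m * (0 ^ (r ∸ m) * K ^ (m ∸ 1)) ≤ h ^ r * K ^ (s ∸ 2)
m*0^[r∸m]*K^[m∸1]≤h^r*K^[s∸2] {h} {K} {r} {s} m K≤h 2≤s s≤r r≤h m≤r with m≤n⇒m<n∨m≡n m≤r
... | inj₁ m<r = subst (_≤ h ^ r * K ^ (s ∸ 2)) (sym term≡0) z≤n
  where
  term≡0 : m * (0 ^ (r ∸ m) * K ^ (m ∸ 1)) ≡ 0
  term≡0 = trans (cong (m *_) (0<e⇒0^e*x≡0 (r ∸ m) _ (m<n⇒0<n∸m m<r))) (*-zeroʳ m)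
... | inj₂ refl = begin
  r * (0 ^ (r ∸ r) * K ^ (r ∸ 1))               ≡⟨ cong (λ e → r * (0 ^ e * K ^ (r ∸ 1))) (n∸n≡0 r) ⟩
  r * (1 * K ^ (r ∸ 1))                         ≡⟨ cong (r *_) (*-identityˡ (K ^ (r ∸ 1))) ⟩
  r * K ^ (r ∸ 1)                               ≡⟨ cong (λ e → r * K ^ e) (r∸1≡[r∸[s∸1]]+[s∸2] 2≤s s≤r) ⟩
  r * K ^ (r ∸ (s ∸ 1) + (s ∸ 2))               ≡⟨ cong (r *_) (^-distribˡ-+-* K (r ∸ (s ∸ 1)) (s ∸ 2)) ⟩
  r * (K ^ (r ∸ (s ∸ 1)) * K ^ (s ∸ 2))         ≤⟨ *-monoʳ-≤ r (*-monoˡ-≤ (K ^ (s ∸ 2))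
                                                                              (^-monoˡ-≤ (r ∸ (s ∸ 1)) K≤h)) ⟩
  r * (h ^ (r ∸ (s ∸ 1)) * K ^ (s ∸ 2))         ≡⟨ *-assoc r (h ^ (r ∸ (s ∸ 1))) (K ^ (s ∸ 2)) ⟨
  r * h ^ (r ∸ (s ∸ 1)) * K ^ (s ∸ 2)           ≤⟨ *-monoˡ-≤ (K ^ (s ∸ 2)) (a*h^[r∸m]≤h^r r (s ∸ 1) r≤h 1≤s∸1 s∸1≤r) ⟩
  h ^ r * K ^ (s ∸ 2)                           ∎
  where
  open ≤-Reasoning
  1≤s∸1 : 1 ≤ s ∸ 1
  1≤s∸1 = ∸-monoˡ-≤ 1 2≤s
  s∸1≤r : s ∸ 1 ≤ r
  s∸1≤r = ≤-trans (m∸n≤m s 1) s≤r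

s∸1<t⇒s≤t×h≤h∸s+t : {h s t : ℕ} → s ≤ h → s ∸ 1 < t → s ≤ t × h ≤ h ∸ s + t
s∸1<t⇒s≤t×h≤h∸s+t {h} {s} {t} s≤h s∸1<t = s≤t , (begin
  h          ≡⟨ m∸n+n≡m s≤h ⟨
  h ∸ s + s  ≤⟨ +-monoʳ-≤ (h ∸ s) s≤t ⟩
  h ∸ s + t  ∎)
  where
  open ≤-Reasoning
  s≤t : s ≤ t
  s≤t = ≤-trans (m≤n+m∸n s 1) s∸1<t

-- Vertices are ordered as b core vertices, c further old vertices and k new ones.
module ThreeParts (b c k : ℕ) where

  core : Subset (b + c + k)
  core = (⊤ {b} ++ ⊥ {c}) ++ ⊥ {k}

  depth : Subset (b + c + k) → ℕ
  depth x = ∣ x ─ core ∣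

  newPart : Subset (b + c + k) → Subset k
  newPart = drop (b + c)

  oldPart : Subset (b + c + k) → Subset (b + c)
  oldPart = take (b + c)

  ∣core∣≡b : ∣ core ∣ ≡ b
  ∣core∣≡b = begin
    ∣ (⊤ {b} ++ ⊥ {c}) ++ ⊥ {k} ∣ ≡⟨ ∣p++q∣≡∣p∣+∣q∣ (⊤ {b} ++ ⊥ {c}) ⊥ ⟩
    ∣ ⊤ {b} ++ ⊥ {c} ∣ + ∣ ⊥ {k} ∣ ≡⟨ cong₂ _+_ (∣p++q∣≡∣p∣+∣q∣ (⊤ {b}) ⊥) (∣⊥∣≡0 k) ⟩
    ∣ ⊤ {b} ∣ + ∣ ⊥ {c} ∣ + 0      ≡⟨ cong₂ (λ u v → u + v + 0) (∣⊤∣≡n b) (∣⊥∣≡0 c) ⟩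
    b + 0 + 0                      ≡⟨ +-identityʳ (b + 0) ⟩
    b + 0                          ≡⟨ +-identityʳ b ⟩
    b                              ∎
    where open ≡-Reasoning

  depth-++ : (xb : Subset b) (xc : Subset c) (xn : Subset k) →
             depth ((xb ++ xc) ++ xn) ≡ ∣ xc ∣ + ∣ xn ∣
  depth-++ xb xc xn = begin
    ∣ ((xb ++ xc) ++ xn) ─ core ∣
      ≡⟨ cong ∣_∣ (zipWith-++ _ (xb ++ xc) xn (⊤ {b} ++ ⊥ {c}) ⊥) ⟩
    ∣ ((xb ++ xc) ─ (⊤ {b} ++ ⊥)) ++ (xn ─ ⊥) ∣
      ≡⟨ cong (λ z → ∣ z ++ (xn ─ ⊥) ∣) (zipWith-++ _ xb xc (⊤ {b}) (⊥ {c})) ⟩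
    ∣ ((xb ─ ⊤) ++ (xc ─ ⊥)) ++ (xn ─ ⊥) ∣
      ≡⟨ cong₂ (λ u v → ∣ (u ++ v) ++ (xn ─ ⊥) ∣) (p─⊤≡⊥ xb) (p─⊥≡p xc) ⟩
    ∣ (⊥ {b} ++ xc) ++ (xn ─ ⊥) ∣              ≡⟨ cong (λ z → ∣ (⊥ {b} ++ xc) ++ z ∣) (p─⊥≡p xn) ⟩
    ∣ (⊥ {b} ++ xc) ++ xn ∣                    ≡⟨ ∣p++q∣≡∣p∣+∣q∣ (⊥ {b} ++ xc) xn ⟩
    ∣ ⊥ {b} ++ xc ∣ + ∣ xn ∣                   ≡⟨ cong (_+ ∣ xn ∣) (∣p++q∣≡∣p∣+∣q∣ (⊥ {b}) xc) ⟩
    ∣ ⊥ {b} ∣ + ∣ xc ∣ + ∣ xn ∣                ≡⟨ cong (λ u → u + ∣ xc ∣ + ∣ xn ∣) (∣⊥∣≡0 b) ⟩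
    ∣ xc ∣ + ∣ xn ∣                            ∎
    where open ≡-Reasoning

  newPart-++ : (y : Subset (b + c)) (xn : Subset k) → newPart (y ++ xn) ≡ xn
  newPart-++ y xn = ++-injectiveʳ (take (b + c) (y ++ xn)) y (take++drop≡id (b + c) (y ++ xn))

  ∣newPart[lift]∣≡0 : (y : Subset (b + c)) → ∣ newPart (lift k y) ∣ ≡ 0
  ∣newPart[lift]∣≡0 y = trans (cong ∣_∣ (newPart-++ y ⊥)) (∣⊥∣≡0 k)

  ∣newPart∣≡0⇒≡lift : (x : Subset (b + c + k)) → ∣ newPart x ∣ ≡ 0 → x ≡ lift k (oldPart x)
  ∣newPart∣≡0⇒≡lift x ∣xn∣≡0 = begin
    x                         ≡⟨ take++drop≡id (b + c) x ⟨
    oldPart x ++ newPart x    ≡⟨ cong (oldPart x ++_) (∣p∣≡0⇒p≡⊥ (newPart x) ∣xn∣≡0) ⟩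
    lift k (oldPart x)        ∎
    where open ≡-Reasoning

  block : ℕ → ℕ → ℕ → List (Subset (b + c + k))
  block p q i = (subsetsOfSize b p ⊗ subsetsOfSize c q) ⊗ subsetsOfSize k i

  layer : ℕ → ℕ → List (Subset (b + c + k))
  layer r m = ⋃₁ m λ j → block (r ∸ m) (m ∸ j) j

  cover : ℕ → ℕ → List (Subset (b + c + k))
  cover r τ = ⋃₁ τ (layer r)

  ∈-cover⁺ : {r τ : ℕ} (x : Subset (b + c + k)) →
             ∣ x ∣ ≡ r → 0 < ∣ newPart x ∣ → depth x ≤ τ → x ∈ₗ cover r τ
  ∈-cover⁺ {r} {τ} x ∣x∣≡r 0<∣xn∣ depth≤τ with splitAt (b + c) x
  ... | y , xn , refl with splitAt b y
  ...   | xb , xc , refl =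
    ∈-⋃₁⁺ τ (≤-trans 1≤j (m≤n+m j ∣ xc ∣)) (subst (_≤ τ) (depth-++ xb xc xn) depth≤τ)
      (∈-⋃₁⁺ m 1≤j (m≤n+m j ∣ xc ∣) x∈block)
    where
    j = ∣ xn ∣
    m = ∣ xc ∣ + j
    1≤j : 1 ≤ j
    1≤j = 0<∣xn∣
    r≡∣xb∣+m : r ≡ ∣ xb ∣ + m
    r≡∣xb∣+m = begin
      r                           ≡⟨ ∣x∣≡r ⟨
      ∣ (xb ++ xc) ++ xn ∣        ≡⟨ ∣p++q∣≡∣p∣+∣q∣ (xb ++ xc) xn ⟩
      ∣ xb ++ xc ∣ + j            ≡⟨ cong (_+ j) (∣p++q∣≡∣p∣+∣q∣ xb xc) ⟩
      ∣ xb ∣ + ∣ xc ∣ + j         ≡⟨ +-assoc ∣ xb ∣ ∣ xc ∣ j ⟩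
      ∣ xb ∣ + m                  ∎
      where open ≡-Reasoning
    x∈block : (xb ++ xc) ++ xn ∈ₗ block (r ∸ m) (m ∸ j) j
    x∈block = ∈-cartesianProductWith⁺ _++_
      (∈-cartesianProductWith⁺ _++_
        (∈-subsetsOfSize⁺ xb (sym (trans (cong (_∸ m) r≡∣xb∣+m) (m+n∸n≡m ∣ xb ∣ m))))
        (∈-subsetsOfSize⁺ xc (sym (m+n∸n≡m ∣ xc ∣ j))))
      (∈-subsetsOfSize⁺ xn refl)

  length-block : (p q i : ℕ) → length (block p q i) ≤ b ^ p * c ^ q * k ^ i
  length-block p q i = begin
    length (block p q i)
      ≡⟨ length-⊗ (subsetsOfSize b p ⊗ subsetsOfSize c q) (subsetsOfSize k i) ⟩
    length (subsetsOfSize b p ⊗ subsetsOfSize c q) * length (subsetsOfSize k i)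
      ≡⟨ cong (_* length (subsetsOfSize k i)) (length-⊗ (subsetsOfSize b p) (subsetsOfSize c q)) ⟩
    length (subsetsOfSize b p) * length (subsetsOfSize c q) * length (subsetsOfSize k i)
      ≤⟨ *-mono-≤ (*-mono-≤ (length-subsetsOfSize b p) (length-subsetsOfSize c q))
                  (length-subsetsOfSize k i) ⟩
    b ^ p * c ^ q * k ^ i ∎
    where open ≤-Reasoning

  length-layer : {K : ℕ} (r m : ℕ) → c ≤ K → k ≤ K →
                 length (layer r m) ≤ m * (b ^ (r ∸ m) * (K ^ (m ∸ 1) * k))
  length-layer {K} r m c≤K k≤K = length-⋃₁ m λ j 1≤j j≤m → begin
    length (block (r ∸ m) (m ∸ j) j)     ≤⟨ length-block (r ∸ m) (m ∸ j) j ⟩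
    b ^ (r ∸ m) * c ^ (m ∸ j) * k ^ j    ≡⟨ *-assoc (b ^ (r ∸ m)) _ _ ⟩
    b ^ (r ∸ m) * (c ^ (m ∸ j) * k ^ j)
      ≤⟨ *-monoʳ-≤ (b ^ (r ∸ m)) (c^[m∸j]*k^j≤K^[m∸1]*k m j c≤K k≤K 1≤j j≤m) ⟩
    b ^ (r ∸ m) * (K ^ (m ∸ 1) * k)      ∎
    where open ≤-Reasoning

  length-cover : {K M : ℕ} (r τ : ℕ) → c ≤ K → k ≤ K →
                 (∀ m → 1 ≤ m → m ≤ τ → m * (b ^ (r ∸ m) * K ^ (m ∸ 1)) ≤ M) →
                 length (cover r τ) ≤ τ * (M * k)
  length-cover {K} {M} r τ c≤K k≤K term≤M = length-⋃₁ τ λ m 1≤m m≤τ → begin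
    length (layer r m)                     ≤⟨ length-layer r m c≤K k≤K ⟩
    m * (b ^ (r ∸ m) * (K ^ (m ∸ 1) * k))  ≡⟨ cong (m *_) (sym (*-assoc (b ^ (r ∸ m)) _ k)) ⟩
    m * (b ^ (r ∸ m) * K ^ (m ∸ 1) * k)    ≡⟨ sym (*-assoc m _ k) ⟩
    m * (b ^ (r ∸ m) * K ^ (m ∸ 1)) * k    ≤⟨ *-monoˡ-≤ k (term≤M m 1≤m m≤τ) ⟩
    M * k                                  ∎
    where open ≤-Reasoning

-- Adding k new vertices to a weakly saturated graph

module Extension {r h : ℕ} (H : RGraph r h) {W : Subset h} (W-in-one-edge : InExactlyOneEdge H W)
                 (b c k τ : ℕ) (room : ∀ t → τ < t → t ≤ r → ∣ W ∣ ≤ t × h ≤ b + t)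
                 (G₀ : RGraph r (b + c)) (G₀-saturated : WeaklySaturated H G₀) where

  open ThreeParts b c k

  private
    N = b + c + k
    L₀ = proj₁ G₀-saturated
    L₀-unique     = proj₁ (proj₁ (proj₂ G₀-saturated))
    L₀-nonEdges   = proj₁ (proj₂ (proj₁ (proj₂ G₀-saturated)))
    L₀-complete   = proj₂ (proj₂ (proj₁ (proj₂ G₀-saturated)))
    L₀-completes  = proj₂ (proj₂ G₀-saturated)

  data Kind (x : Subset N) : Set where
    old     : (y : Subset (b + c)) → x ≡ lift k y → Kind x
    shallow : 0 < ∣ newPart x ∣ → depth x ≤ τ → Kind x
    deep    : 0 < ∣ newPart x ∣ → τ < depth x → Kind x

  kind : (x : Subset N) → Kind x
  kind x with ∣ newPart x ∣ ≟ 0 | depth x ≤? τ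
  ... | yes ∣xn∣≡0 | _        = old (oldPart x) (∣newPart∣≡0⇒≡lift x ∣xn∣≡0)
  ... | no  ∣xn∣≢0 | yes d≤τ  = shallow (n≢0⇒n>0 ∣xn∣≢0) d≤τ
  ... | no  ∣xn∣≢0 | no  d≰τ  = deep (n≢0⇒n>0 ∣xn∣≢0) (≰⇒> d≰τ)

  Shallow : Subset N → Set
  Shallow x = ∣ x ∣ ≡ r × 0 < ∣ newPart x ∣ × depth x ≤ τ

  shallow? : Decidable Shallow
  shallow? x = (∣ x ∣ ≟ r) ×-dec (0 <? ∣ newPart x ∣) ×-dec (depth x ≤? τ)

  -- Filtering cover r τ rather than all r-sets makes the size bound immediate.
  candidates : List (Subset N)
  candidates = List.map (lift k) (edges G₀) List.++ filter shallow? (cover r τ)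

  edgesG : List (Subset N)
  edgesG = deduplicate _≟ₛ_ candidates

  ∈-edgesG⁻ : ∀ {x} → x ∈ₗ edgesG → (∃ λ y → y ∈ₗ edges G₀ × x ≡ lift k y) ⊎ Shallow x
  ∈-edgesG⁻ x∈ with ∈-++⁻ (List.map (lift k) (edges G₀)) (∈-deduplicate⁻ _≟ₛ_ candidates x∈)
  ... | inj₁ x∈lifted = inj₁ (∈-map⁻ (lift k) x∈lifted)
  ... | inj₂ x∈added  = inj₂ (proj₂ (∈-filter⁻ shallow? {xs = cover r τ} x∈added))

  lift∈edgesG : ∀ {y} → y ∈ₗ edges G₀ → lift k y ∈ₗ edgesG
  lift∈edgesG y∈ = ∈-deduplicate⁺ _≟ₛ_ (∈-++⁺ˡ (∈-map⁺ (lift k) y∈))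

  shallow∈edgesG : ∀ {x} → Shallow x → x ∈ₗ edgesG
  shallow∈edgesG {x} (∣x∣≡r , 0<∣xn∣ , d≤τ) =
    ∈-deduplicate⁺ _≟ₛ_ (∈-++⁺ʳ (List.map (lift k) (edges G₀))
      (∈-filter⁺ shallow? (∈-cover⁺ x ∣x∣≡r 0<∣xn∣ d≤τ) (∣x∣≡r , 0<∣xn∣ , d≤τ)))

  G : RGraph r N
  G = record
    { edges   = edgesG
    ; unique  = deduplicate-! _≟ₛ_ candidates
    ; uniform = All.tabulate uniform′
    }
    where
    uniform′ : ∀ {x} → x ∈ₗ edgesG → ∣ x ∣ ≡ r
    uniform′ x∈ with ∈-edgesG⁻ x∈
    ... | inj₁ (y , y∈G₀ , refl) = trans (∣lift∣≡∣p∣ k y) (All.lookup (uniform G₀) y∈G₀)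
    ... | inj₂ (∣x∣≡r , _)       = ∣x∣≡r

  ∥G∥≤∥G₀∥+∣cover∣ : ∥ G ∥ ≤ ∥ G₀ ∥ + length (cover r τ)
  ∥G∥≤∥G₀∥+∣cover∣ = begin
    length edgesG
      ≤⟨ length-deduplicate _≟ₛ_ candidates ⟩
    length candidates
      ≡⟨ length-++ (List.map (lift k) (edges G₀)) ⟩
    length (List.map (lift k) (edges G₀)) + length (filter shallow? (cover r τ))
      ≤⟨ +-mono-≤ (≤-reflexive (length-map (lift k) (edges G₀))) (length-filter shallow? (cover r τ)) ⟩
    ∥ G₀ ∥ + length (cover r τ) ∎
    where open ≤-Reasoning

  AtLevel : ℕ → Subset N → Set
  AtLevel t x = 0 < ∣ newPart x ∣ × τ < t × depth x ≡ t

  atLevel? : (t : ℕ) → Decidable (AtLevel t)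
  atLevel? t x = (0 <? ∣ newPart x ∣) ×-dec (τ <? t) ×-dec (depth x ≟ t)

  level : ℕ → List (Subset N)
  level t = filter (atLevel? t) (subsetsOfSize N r)

  below : ℕ → List (Subset N)
  below zero    = []
  below (suc t) = below t List.++ level t

  ∈-level⁻ : ∀ {t x} → x ∈ₗ level t → ∣ x ∣ ≡ r × AtLevel t x
  ∈-level⁻ {t} x∈ with ∈-filter⁻ (atLevel? t) {xs = subsetsOfSize N r} x∈
  ... | x∈sub , atLevel = ∈-subsetsOfSize⁻ N r x∈sub , atLevel

  ∈-below⁻ : ∀ t {x} → x ∈ₗ below t → ∣ x ∣ ≡ r × 0 < ∣ newPart x ∣ × τ < depth x × depth x < t
  ∈-below⁻ (suc t) x∈ with ∈-++⁻ (below t) x∈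
  ... | inj₁ x∈below with ∈-below⁻ t x∈below
  ...   | ∣x∣≡r , 0<∣xn∣ , τ<d , d<t = ∣x∣≡r , 0<∣xn∣ , τ<d , m≤n⇒m≤1+n d<t
  ∈-below⁻ (suc t) x∈ | inj₂ x∈level with ∈-level⁻ x∈level
  ...   | ∣x∣≡r , 0<∣xn∣ , τ<t , refl = ∣x∣≡r , 0<∣xn∣ , τ<t , ≤-refl

  ∈-below⁺ : ∀ t {x} → ∣ x ∣ ≡ r → 0 < ∣ newPart x ∣ → τ < depth x → depth x < t → x ∈ₗ below t
  ∈-below⁺ (suc t) {x} ∣x∣≡r 0<∣xn∣ τ<d d<1+t with depth x ≟ t
  ... | yes refl =
    ∈-++⁺ʳ (below t) (∈-filter⁺ (atLevel? t) (∈-subsetsOfSize⁺ x ∣x∣≡r) (0<∣xn∣ , τ<d , refl))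
  ... | no  d≢t  = ∈-++⁺ˡ (∈-below⁺ t ∣x∣≡r 0<∣xn∣ τ<d (≤∧≢⇒< (≤-pred d<1+t) d≢t))

  below-unique : ∀ t → Unique (below t)
  below-unique zero    = []
  below-unique (suc t) =
    Unique.++⁺ (below-unique t) (Unique.filter⁺ (atLevel? t) (subsetsOfSize-unique N r))
      λ (x∈below , x∈level) →
        <⇒≢ (proj₂ (proj₂ (proj₂ (∈-below⁻ t x∈below)))) (proj₂ (proj₂ (proj₂ (∈-level⁻ x∈level))))

  depth≤r : ∀ x → ∣ x ∣ ≡ r → depth x ≤ r
  depth≤r x ∣x∣≡r = subst (depth x ≤_) ∣x∣≡r (∣p─q∣≤∣p∣ x core)

  ordering : List (Subset N)
  ordering = List.map (lift k) L₀ List.++ below (suc r)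

  ordering-unique : Unique ordering
  ordering-unique = Unique.++⁺ (Unique.map⁺ (lift-injective k) L₀-unique) (below-unique (suc r))
    λ (x∈lifted , x∈below) →
      let (y , _ , x≡lift) = ∈-map⁻ (lift k) x∈lifted in
      <⇒≢ (proj₁ (proj₂ (∈-below⁻ (suc r) x∈below)))
          (sym (trans (cong (∣_∣ ∘ newPart) x≡lift) (∣newPart[lift]∣≡0 y)))

  lift∉edgesG : ∀ {y} → y ∉ₗ edges G₀ → lift k y ∉ₗ edgesG
  lift∉edgesG {y} y∉G₀ lift∈ with ∈-edgesG⁻ lift∈
  ... | inj₁ (y′ , y′∈G₀ , eq)  = y∉G₀ (subst (_∈ₗ edges G₀) (sym (lift-injective k eq)) y′∈G₀)
  ... | inj₂ (_ , 0<∣xn∣ , _)   = <⇒≢ 0<∣xn∣ (sym (∣newPart[lift]∣≡0 y))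

  deep∉edgesG : ∀ {x} → 0 < ∣ newPart x ∣ → τ < depth x → x ∉ₗ edgesG
  deep∉edgesG {x} 0<∣xn∣ τ<d x∈ with ∈-edgesG⁻ x∈
  ... | inj₁ (y , _ , refl) = <⇒≢ 0<∣xn∣ (sym (∣newPart[lift]∣≡0 y))
  ... | inj₂ (_ , _ , d≤τ)  = <⇒≱ τ<d d≤τ

  ordering-nonEdges : All.All (λ e → ∣ e ∣ ≡ r × e ∉ₗ edgesG) ordering
  ordering-nonEdges = All.tabulate nonEdge
    where
    nonEdge : ∀ {x} → x ∈ₗ ordering → ∣ x ∣ ≡ r × x ∉ₗ edgesG
    nonEdge x∈ with ∈-++⁻ (List.map (lift k) L₀) x∈
    ... | inj₁ x∈lifted with ∈-map⁻ (lift k) x∈lifted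
    ...   | y , y∈L₀ , refl = trans (∣lift∣≡∣p∣ k y) (proj₁ (All.lookup L₀-nonEdges y∈L₀)) ,
                              lift∉edgesG (proj₂ (All.lookup L₀-nonEdges y∈L₀))
    nonEdge x∈ | inj₂ x∈below with ∈-below⁻ (suc r) x∈below
    ...   | ∣x∣≡r , 0<∣xn∣ , τ<d , _ = ∣x∣≡r , deep∉edgesG 0<∣xn∣ τ<d

  ordering-complete : ∀ x → ∣ x ∣ ≡ r → x ∉ₗ edgesG → x ∈ₗ ordering
  ordering-complete x ∣x∣≡r x∉ with kind x
  ... | old y refl         =
    ∈-++⁺ˡ (∈-map⁺ (lift k) (L₀-complete y (trans (sym (∣lift∣≡∣p∣ k y)) ∣x∣≡r) (x∉ ∘ lift∈edgesG)))
  ... | shallow 0<∣xn∣ d≤τ = contradiction (shallow∈edgesG (∣x∣≡r , 0<∣xn∣ , d≤τ)) x∉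
  ... | deep 0<∣xn∣ τ<d    =
    ∈-++⁺ʳ (List.map (lift k) L₀) (∈-below⁺ (suc r) ∣x∣≡r 0<∣xn∣ τ<d (s≤s (depth≤r x ∣x∣≡r)))

  processed : ℕ → List (Subset N)
  processed t = below t ʳ++ List.map (lift k) L₀ ʳ++ edgesG

  completes-lifted : Completes H edgesG (List.map (lift k) L₀)
  completes-lifted =
    completes-mono H (List.map (lift k) L₀) lifted⊆edgesG (completes-lift k H (edges G₀) L₀ L₀-completes)
    where
    lifted⊆edgesG : List.map (lift k) (edges G₀) ⊆ₗ edgesG
    lifted⊆edgesG x∈ with ∈-map⁻ (lift k) x∈
    ... | y , y∈G₀ , refl = lift∈edgesG y∈G₀

  depth<t⇒∈processed : ∀ t I → ∣ I ∣ ≡ r → depth I < t → I ∈ₗ processed t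
  depth<t⇒∈processed t I ∣I∣≡r d<t with kind I
  ... | old y refl with (_∈ₗ?_ _≟ₛ_) y (edges G₀)
  ...   | yes y∈G₀ = ∈-ʳ++⁺ʳ (below t) (∈-ʳ++⁺ʳ (List.map (lift k) L₀) (lift∈edgesG y∈G₀))
  ...   | no  y∉G₀ = ∈-ʳ++⁺ʳ (below t) (∈-ʳ++⁺ˡ (∈-map⁺ (lift k) (L₀-complete y ∣y∣≡r y∉G₀)))
    where
    ∣y∣≡r : ∣ y ∣ ≡ r
    ∣y∣≡r = trans (sym (∣lift∣≡∣p∣ k y)) ∣I∣≡r
  depth<t⇒∈processed t I ∣I∣≡r d<t | shallow 0<∣xn∣ d≤τ =
    ∈-ʳ++⁺ʳ (below t) (∈-ʳ++⁺ʳ (List.map (lift k) L₀) (shallow∈edgesG (∣I∣≡r , 0<∣xn∣ , d≤τ)))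
  depth<t⇒∈processed t I ∣I∣≡r d<t | deep 0<∣xn∣ τ<d = ∈-ʳ++⁺ˡ (∈-below⁺ t ∣I∣≡r 0<∣xn∣ τ<d d<t)

  completes-below : ∀ t → Completes H (processed 0) (below t)
  completes-below zero    = _
  completes-below (suc t) =
    completes-++ H (processed 0) (below t) (completes-below t)
                 (completes-independently H (level t) copy (λ x∈ → x∈))
    where
    copy : ∀ {e} → e ∈ₗ level t → CopyContaining H (e ∷ processed t) e
    copy {e} e∈ with ∈-level⁻ e∈
    ... | ∣e∣≡r , _ , τ<t , d≡t =
      copyContaining-fromShallower H W-in-one-edge core (processed t) ∣e∣≡r
        (subst (0 <_) (sym d≡t) (≤-trans (s≤s z≤n) τ<t))
        (subst (∣ W ∣ ≤_) (sym d≡t) (proj₁ (room t τ<t t≤r)))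
        (subst₂ (λ u v → h ≤ u + v) (sym ∣core∣≡b) (sym d≡t) (proj₂ (room t τ<t t≤r)))
        (λ I ∣I∣≡r d<d → depth<t⇒∈processed t I ∣I∣≡r (subst (depth I <_) d≡t d<d))
      where
      t≤r : t ≤ r
      t≤r = subst (_≤ r) d≡t (depth≤r e ∣e∣≡r)

  G-saturated : WeaklySaturated H G
  G-saturated = ordering , (ordering-unique , ordering-nonEdges , ordering-complete) ,
                completes-++ H edgesG (List.map (lift k) L₀) completes-lifted (completes-below (suc r))

wsat-extension : (H : RGraph r h) {W : Subset h} → InExactlyOneEdge H W → (b c k τ : ℕ) →
                 (∀ t → τ < t → t ≤ r → ∣ W ∣ ≤ t × h ≤ b + t) →
                 {m₁ m₂ : ℕ} → IsWsat (b + c) H m₁ → IsWsat (b + c + k) H m₂ →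
                 m₂ ≤ m₁ + length (ThreeParts.cover b c k r τ)
wsat-extension {r} H W-in-one-edge b c k τ room {m₁} {m₂}
               ((G₀ , G₀-saturated , ∥G₀∥≡m₁) , _) (_ , minimal) = begin
  m₂                                   ≤⟨ minimal G G-saturated ⟩
  ∥ G ∥                                ≤⟨ ∥G∥≤∥G₀∥+∣cover∣ ⟩
  ∥ G₀ ∥ + length (cover r τ)          ≡⟨ cong (_+ length (cover r τ)) ∥G₀∥≡m₁ ⟩
  m₁ + length (cover r τ)              ∎
  where
  open Extension H W-in-one-edge b c k τ room G₀ G₀-saturated
  open ThreeParts b c k
  open ≤-Reasoning

wsat-extension-bound : (H : RGraph r h) {W : Subset h} → InExactlyOneEdge H W →
  (b c τ : ℕ) {k₁ k₂ P Q m₁ m₂ : ℕ} → b + c ≡ k₁ → k₂ ≤ k₁ → τ ≤ r →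
  (∀ t → τ < t → t ≤ r → ∣ W ∣ ≤ t × h ≤ b + t) →
  (∀ m → 1 ≤ m → m ≤ τ → m * (b ^ (r ∸ m) * k₁ ^ (m ∸ 1)) ≤ P * Q) →
  IsWsat k₁ H m₁ → IsWsat (k₁ + k₂) H m₂ → m₂ ≤ m₁ + r * P * Q * k₂
wsat-extension-bound {r} H W-in-one-edge b c τ {k₂ = k₂} {P} {Q} {m₁} {m₂}
                     refl k₂≤k₁ τ≤r room term≤PQ wsat₁ wsat₂ = begin
  m₂                       ≤⟨ wsat-extension H W-in-one-edge b c k₂ τ room wsat₁ wsat₂ ⟩
  m₁ + length (cover r τ)  ≤⟨ +-monoʳ-≤ m₁ (length-cover r τ (m≤n+m c b) k₂≤k₁ term≤PQ) ⟩
  m₁ + τ * (P * Q * k₂)    ≤⟨ +-monoʳ-≤ m₁ (*-monoˡ-≤ (P * Q * k₂) τ≤r) ⟩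
  m₁ + r * (P * Q * k₂)    ≡⟨ cong (m₁ +_) (*-assoc r (P * Q) k₂) ⟨
  m₁ + r * (P * Q) * k₂    ≡⟨ cong (λ z → m₁ + z * k₂) (*-assoc r P Q) ⟨
  m₁ + r * P * Q * k₂      ∎
  where
  open ThreeParts b c k₂
  open ≤-Reasoning

corollary2p5 : ∀ (h r s : ℕ) → 2 ≤ s → s ≤ r → r ≤ h →
    (H : RGraph r h) → IsSparseness H s →
    ∀ (k₁ k₂ : ℕ) → k₂ ≤ k₁ → 1 ≤ k₁ →
    ∀ (m₁ m₂ : ℕ) → IsWsat k₁ H m₁ → IsWsat (k₁ + k₂) H m₂ →
    m₂ ≤ m₁ + r * h ^ r * k₁ ^ (s ∸ 2) * k₂
corollary2p5 h r s 2≤s s≤r r≤h H ((W , W-in-one-edge , ∣W∣≡s) , _) k₁ k₂ k₂≤k₁ 1≤k₁ m₁ m₂ wsat₁ wsat₂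
  with h ∸ s ≤? k₁
... | yes h∸s≤k₁ =
  wsat-extension-bound H W-in-one-edge (h ∸ s) (k₁ ∸ (h ∸ s)) (s ∸ 1)
    (m+[n∸m]≡n h∸s≤k₁) k₂≤k₁ (≤-trans (m∸n≤m s 1) s≤r)
    (λ t s∸1<t _ → subst (λ w → w ≤ t × h ≤ h ∸ s + t) (sym ∣W∣≡s)
                         (s∸1<t⇒s≤t×h≤h∸s+t (≤-trans s≤r r≤h) s∸1<t))
    (λ m 1≤m m≤s∸1 → m*b^[r∸m]*K^[m∸1]≤h^r*K^[s∸2] m (m∸n≤m h s) 1≤k₁ s≤r r≤h 1≤m m≤s∸1)
    wsat₁ wsat₂
... | no h∸s≰k₁ =
  wsat-extension-bound H W-in-one-edge 0 k₁ r refl k₂≤k₁ ≤-refl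
    (λ t r<t t≤r → contradiction t≤r (<⇒≱ r<t))
    (λ m _ m≤r → m*0^[r∸m]*K^[m∸1]≤h^r*K^[s∸2] m k₁≤h 2≤s s≤r r≤h m≤r)
    wsat₁ wsat₂
  where
  k₁≤h : k₁ ≤ h
  k₁≤h = ≤-trans (<⇒≤ (≰⇒> h∸s≰k₁)) (m∸n≤m h s)
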